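{- Let $n \geq 0$ and $0 \leq k \leq n$ be integers. Then $$\begin{bmatrix} n \\ k \end{bmatrix}_q = \sum_{v \in \Omega''_{n,k}} q^{\operatorname{inv}(v)} \cdot (1+q)^{\operatorname{asc}_{\mathrm{odd}}(v)}.$$
   Context: $\begin{bmatrix} n \\ k \end{bmatrix}_q$ is the Gaussian ($q$-binomial) coefficient $\frac{[n]_q!}{[k]_q!\,[n-k]_q!}$ where $[m]_q! = \prod_{i=1}^m (1+q+\cdots+q^{i-1})$. $\Omega_{n,k}$ is the set of words $w=w_1\cdots w_n$ over $\{0,1\}$ with $n-k$ zeroes and $k$ ones, and $\Omega''_{n,k}$ is the set of $v \in \Omega_{n,k}$ with $v_1 \leq v_2$, $v_3 \leq v_4$, $\ldots$, $v_{2\lfloor n/2\rfloor-1} \leq v_{2\lfloor n/2\rfloor}$ (no condition on $v_n$ for $n$ odd). For a word $w$, $\operatorname{inv}(w) = |\{(i,j) : 1 \leq i < j \leq n,\ w_i > w_j\}|$. For $v \in \Omega''_{n,k}$, $\operatorname{asc}_{\mathrm{odd}}(v) = |\{ i : i \text{ odd},\ v_i < v_{i+1}\}|$. -}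

module Defs where

open import Data.Nat using (ℕ; zero; suc; _+_; _*_; _≡ᵇ_)
open import Data.Bool using (Bool; true; false; _∧_; _∨_; not; if_then_else_)
open import Data.List using (List; []; _∷_; map; concatMap; replicate; _++_)
open import Relation.Binary.PropositionalEquality using (_≡_)

-- Polynomials in q with natural-number coefficients, as coefficient
-- lists (constant term first).  Equality is coefficientwise.

Poly : Set
Poly = List ℕ

coeff : Poly → ℕ → ℕ
coeff []       _       = 0
coeff (a ∷ p)  zero    = a
coeff (a ∷ p)  (suc i) = coeff p i

_≈P_ : Poly → Poly → Set
p ≈P r = ∀ i → coeff p i ≡ coeff r i

infix 4 _≈P_
infixl 6 _+P_
infixl 7 _*P_

_+P_ : Poly → Poly → Poly
[]      +P r       = r
(a ∷ p) +P []      = a ∷ p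
(a ∷ p) +P (b ∷ r) = (a + b) ∷ (p +P r)

scale : ℕ → Poly → Poly
scale c = map (c *_)

_*P_ : Poly → Poly → Poly
[]      *P r = []
(a ∷ p) *P r = scale a r +P (0 ∷ (p *P r))

oneP : Poly
oneP = 1 ∷ []

_^P_ : Poly → ℕ → Poly
p ^P zero  = oneP
p ^P suc m = p *P (p ^P m)

qpow : ℕ → Poly
qpow m = replicate m 0 ++ (1 ∷ [])

onePlusQ : Poly
onePlusQ = 1 ∷ 1 ∷ []

qint : ℕ → Poly
qint m = replicate m 1

qfact : ℕ → Poly
qfact zero    = oneP
qfact (suc m) = qint (suc m) *P qfact m

sumP : List Poly → Poly
sumP []       = []
sumP (p ∷ ps) = p +P sumP ps

-- Binary words (false = 0, true = 1)

allWords : ℕ → List (List Bool)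
allWords zero    = [] ∷ []
allWords (suc n) = concatMap (λ w → (false ∷ w) ∷ (true ∷ w) ∷ []) (allWords n)

ones : List Bool → ℕ
ones []          = 0
ones (true ∷ w)  = suc (ones w)
ones (false ∷ w) = ones w

zeros : List Bool → ℕ
zeros []          = 0
zeros (true ∷ w)  = zeros w
zeros (false ∷ w) = suc (zeros w)

-- inv(w) = #{ i < j : w_i > w_j } = for each 1, number of 0s after it
inv : List Bool → ℕ
inv []          = 0
inv (true ∷ w)  = zeros w + inv w
inv (false ∷ w) = inv w

-- v_1 ≤ v_2, v_3 ≤ v_4, ... (no condition on a final unpaired letter)
pairsOrdered : List Bool → Bool
pairsOrdered (a ∷ b ∷ w) = (not a ∨ b) ∧ pairsOrdered w
pairsOrdered _           = true

-- asc_odd(v) = #{ i odd : v_i < v_{i+1} }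
ascOdd : List Bool → ℕ
ascOdd (a ∷ b ∷ w) = (if not a ∧ b then 1 else 0) + ascOdd w
ascOdd _           = 0

filterB : {A : Set} → (A → Bool) → List A → List A
filterB p []       = []
filterB p (x ∷ xs) = if p x then x ∷ filterB p xs else filterB p xs

-- Ω''_{n,k} (as a duplicate-free list)
Omega'' : ℕ → ℕ → List (List Bool)
Omega'' n k = filterB (λ w → (ones w ≡ᵇ k) ∧ pairsOrdered w) (allWords n)

{-# OPTIONS --safe #-}
-- Cut a word of Ω''_{a+k,k} after its first two letters. The pair 10 is excluded, 00 leaves a
-- word of Ω''_{a+k-2,k}, 01 is an odd ascent whose 1 precedes the remaining a-1 zeros and so
-- contributes q^(a-1)(1+q), and 11 contributes q^(2a). The sum G(a,k) therefore satisfies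
--   G(a,k) = G(a-2,k) + q^(a-1)(1+q) G(a-1,k-1) + q^(2a) G(a,k-2),
-- and after multiplying by [a]![k]! the Gaussian coefficient obeys the same recurrence because
--   [a][a-1] + q^(a-1)(1+q)[a][k] + q^(2a)[k][k-1] = [a+k][a+k-1].
-- Induction on a+k in steps of two finishes the proof.
module Submission where

open import Defs
open import Data.Nat using (ℕ; zero; suc; _+_; _*_; _∸_; _≤_; _≡ᵇ_)
open import Data.Nat.Properties
  using ( +-comm; +-assoc; +-identityʳ; +-suc; suc-injective; m+n∸n≡m; m∸n+n≡m; ≡ᵇ⇒≡; ≡⇒≡ᵇ
        ; *-comm; *-assoc; *-identityˡ; *-zeroʳ; *-distribˡ-+; *-distribʳ-+)
open import Data.Bool using (Bool; true; false; T; _∧_; if_then_else_)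
open import Data.Bool.Properties using (∧-zeroʳ)
open import Data.List using (List; []; _∷_; map; length; concatMap)
open import Data.Product using (_,_)
open import Algebra.Bundles using (CommutativeSemiring)
open import Algebra.Structures.Biased using (isCommutativeSemiringˡ)
open import Relation.Binary.Bundles using (Setoid)
open import Relation.Binary.Structures using (IsEquivalence)
open import Relation.Binary.PropositionalEquality
  using (_≡_; refl; sym; trans; cong; cong₂; module ≡-Reasoning)
import Relation.Binary.Reasoning.Setoid as SetoidReasoning

-- A record rather than a synonym for _≈P_, so that both polynomials can be
-- inferred from the type of an equation.
infix 4 _≋_
record _≋_ (p r : Poly) : Set where
  constructor mk≋
  field coeff-≡ : p ≈P r
open _≋_

≋-isEquivalence : IsEquivalence _≋_
≋-isEquivalence = record
  { refl  = mk≋ λ _ → refl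
  ; sym   = λ (mk≋ e) → mk≋ λ i → sym (e i)
  ; trans = λ (mk≋ e) (mk≋ f) → mk≋ λ i → trans (e i) (f i)
  }

≋-setoid : Setoid _ _
≋-setoid = record { isEquivalence = ≋-isEquivalence }

open Setoid ≋-setoid using () renaming (refl to ≋-refl; sym to ≋-sym; trans to ≋-trans; reflexive to ≡⇒≋)

∷-cong : ∀ {a b p r} → a ≡ b → p ≋ r → a ∷ p ≋ b ∷ r
∷-cong a≡b (mk≋ e) = mk≋ λ { zero → a≡b ; (suc i) → e i }

0∷[]≋[] : 0 ∷ [] ≋ []
0∷[]≋[] = mk≋ λ { zero → refl ; (suc i) → refl }

coeff-+P : ∀ p r i → coeff (p +P r) i ≡ coeff p i + coeff r i
coeff-+P []      r       i       = refl
coeff-+P (a ∷ p) []      i       = sym (+-identityʳ _)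
coeff-+P (a ∷ p) (b ∷ r) zero    = refl
coeff-+P (a ∷ p) (b ∷ r) (suc i) = coeff-+P p r i

coeff-scale : ∀ c p i → coeff (scale c p) i ≡ c * coeff p i
coeff-scale c []      i       = sym (*-zeroʳ c)
coeff-scale c (a ∷ p) zero    = refl
coeff-scale c (a ∷ p) (suc i) = coeff-scale c p i

+P-cong : ∀ {p p′ r r′} → p ≋ p′ → r ≋ r′ → p +P r ≋ p′ +P r′
+P-cong {p} {p′} {r} {r′} (mk≋ e) (mk≋ f) = mk≋ λ i →
  trans (coeff-+P p r i) (trans (cong₂ _+_ (e i) (f i)) (sym (coeff-+P p′ r′ i)))

+P-identityʳ : ∀ p → p +P [] ≡ p
+P-identityʳ []      = refl
+P-identityʳ (a ∷ p) = refl

+P-comm : ∀ p r → p +P r ≡ r +P p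
+P-comm []      r       = sym (+P-identityʳ r)
+P-comm (a ∷ p) []      = refl
+P-comm (a ∷ p) (b ∷ r) = cong₂ _∷_ (+-comm a b) (+P-comm p r)

+P-assoc : ∀ p r s → (p +P r) +P s ≡ p +P (r +P s)
+P-assoc []      r       s       = refl
+P-assoc (a ∷ p) []      s       = refl
+P-assoc (a ∷ p) (b ∷ r) []      = refl
+P-assoc (a ∷ p) (b ∷ r) (c ∷ s) = cong₂ _∷_ (+-assoc a b c) (+P-assoc p r s)

+P-left-comm : ∀ p r s → p +P (r +P s) ≡ r +P (p +P s)
+P-left-comm p r s = begin
  p +P (r +P s)  ≡⟨ sym (+P-assoc p r s) ⟩
  (p +P r) +P s  ≡⟨ cong (_+P s) (+P-comm p r) ⟩
  (r +P p) +P s  ≡⟨ +P-assoc r p s ⟩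
  r +P (p +P s)  ∎
  where open ≡-Reasoning

+P-interchange : ∀ p r s t → (p +P r) +P (s +P t) ≡ (p +P s) +P (r +P t)
+P-interchange p r s t = begin
  (p +P r) +P (s +P t)  ≡⟨ +P-assoc p r (s +P t) ⟩
  p +P (r +P (s +P t))  ≡⟨ cong (p +P_) (+P-left-comm r s t) ⟩
  p +P (s +P (r +P t))  ≡⟨ sym (+P-assoc p s (r +P t)) ⟩
  (p +P s) +P (r +P t)  ∎
  where open ≡-Reasoning

scale-cong : ∀ c {p r} → p ≋ r → scale c p ≋ scale c r
scale-cong c {p} {r} (mk≋ e) = mk≋ λ i →
  trans (coeff-scale c p i) (trans (cong (c *_) (e i)) (sym (coeff-scale c r i)))

scale-zero : ∀ p → scale 0 p ≋ []
scale-zero p = mk≋ (coeff-scale 0 p)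

scale-one : ∀ p → scale 1 p ≡ p
scale-one []      = refl
scale-one (a ∷ p) = cong₂ _∷_ (*-identityˡ a) (scale-one p)

scale-+P : ∀ c p r → scale c (p +P r) ≡ scale c p +P scale c r
scale-+P c []      r       = refl
scale-+P c (a ∷ p) []      = refl
scale-+P c (a ∷ p) (b ∷ r) = cong₂ _∷_ (*-distribˡ-+ c a b) (scale-+P c p r)

scale-distribʳ : ∀ a b p → scale (a + b) p ≡ scale a p +P scale b p
scale-distribʳ a b []      = refl
scale-distribʳ a b (c ∷ p) = cong₂ _∷_ (*-distribʳ-+ c a b) (scale-distribʳ a b p)

scale-scale : ∀ a b p → scale a (scale b p) ≡ scale (a * b) p
scale-scale a b []      = refl
scale-scale a b (c ∷ p) = cong₂ _∷_ (sym (*-assoc a b c)) (scale-scale a b p)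

*P-zeroʳ : ∀ p → p *P [] ≋ []
*P-zeroʳ []      = ≋-refl
*P-zeroʳ (a ∷ p) = ≋-trans (∷-cong refl (*P-zeroʳ p)) 0∷[]≋[]

*P-identityˡ : ∀ p → oneP *P p ≋ p
*P-identityˡ p = ≋-trans (+P-cong (≡⇒≋ (scale-one p)) 0∷[]≋[]) (≡⇒≋ (+P-identityʳ p))

*P-congʳ : ∀ p {r r′} → r ≋ r′ → p *P r ≋ p *P r′
*P-congʳ []      e = ≋-refl
*P-congʳ (a ∷ p) e = +P-cong (scale-cong a e) (∷-cong refl (*P-congʳ p e))

*P-∷ʳ : ∀ p a r → p *P (a ∷ r) ≋ scale a p +P (0 ∷ p *P r)
*P-∷ʳ []      a r = ≋-sym 0∷[]≋[]
*P-∷ʳ (b ∷ p) a r = ∷-cong (cong (_+ 0) (*-comm b a))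
  (≋-trans (+P-cong (≋-refl {scale b r}) (*P-∷ʳ p a r))
           (≡⇒≋ (+P-left-comm (scale b r) (scale a p) (0 ∷ p *P r))))

*P-comm : ∀ p r → p *P r ≋ r *P p
*P-comm []      r = ≋-sym (*P-zeroʳ r)
*P-comm (a ∷ p) r =
  ≋-trans (+P-cong (≋-refl {scale a r}) (∷-cong refl (*P-comm p r))) (≋-sym (*P-∷ʳ r a p))

*P-congˡ : ∀ {p p′} r → p ≋ p′ → p *P r ≋ p′ *P r
*P-congˡ {p} {p′} r e = ≋-trans (*P-comm p r) (≋-trans (*P-congʳ r e) (*P-comm r p′))

*P-cong : ∀ {p p′ r r′} → p ≋ p′ → r ≋ r′ → p *P r ≋ p′ *P r′
*P-cong {p′ = p′} {r = r} e f = ≋-trans (*P-congˡ r e) (*P-congʳ p′ f)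

*P-distribʳ : ∀ r p s → (p +P s) *P r ≡ p *P r +P s *P r
*P-distribʳ r []      s       = refl
*P-distribʳ r (a ∷ p) []      = sym (+P-identityʳ _)
*P-distribʳ r (a ∷ p) (b ∷ s) = begin
  scale (a + b) r +P (0 ∷ (p +P s) *P r)
    ≡⟨ cong₂ (λ x y → x +P (0 ∷ y)) (scale-distribʳ a b r) (*P-distribʳ r p s) ⟩
  (scale a r +P scale b r) +P ((0 ∷ p *P r) +P (0 ∷ s *P r))
    ≡⟨ +P-interchange (scale a r) (scale b r) (0 ∷ p *P r) (0 ∷ s *P r) ⟩
  (scale a r +P (0 ∷ p *P r)) +P (scale b r +P (0 ∷ s *P r))  ∎
  where open ≡-Reasoning

*P-distribˡ : ∀ c p r → c *P (p +P r) ≋ c *P p +P c *P r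
*P-distribˡ c p r = ≋-trans (*P-comm c (p +P r))
  (≋-trans (≡⇒≋ (*P-distribʳ c p r)) (+P-cong (*P-comm p c) (*P-comm r c)))

scale-*P : ∀ a p r → scale a p *P r ≡ scale a (p *P r)
scale-*P a []      r = refl
scale-*P a (b ∷ p) r = begin
  scale (a * b) r +P (0 ∷ scale a p *P r)
    ≡⟨ cong₂ (λ x y → x +P (y ∷ scale a p *P r)) (sym (scale-scale a b r)) (sym (*-zeroʳ a)) ⟩
  scale a (scale b r) +P (a * 0 ∷ scale a p *P r)
    ≡⟨ cong (λ x → scale a (scale b r) +P (a * 0 ∷ x)) (scale-*P a p r) ⟩
  scale a (scale b r) +P scale a (0 ∷ p *P r)
    ≡⟨ sym (scale-+P a (scale b r) (0 ∷ p *P r)) ⟩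
  scale a (scale b r +P (0 ∷ p *P r))  ∎
  where open ≡-Reasoning

*P-assoc : ∀ p r s → (p *P r) *P s ≋ p *P (r *P s)
*P-assoc []      r s = ≋-refl
*P-assoc (a ∷ p) r s = begin
  (scale a r +P (0 ∷ p *P r)) *P s             ≡⟨ *P-distribʳ s (scale a r) (0 ∷ p *P r) ⟩
  scale a r *P s +P (0 ∷ p *P r) *P s          ≡⟨ cong (_+P (0 ∷ p *P r) *P s) (scale-*P a r s) ⟩
  scale a (r *P s) +P (scale 0 s +P (0 ∷ (p *P r) *P s))
    ≈⟨ +P-cong ≋-refl (+P-cong (scale-zero s) (∷-cong refl (*P-assoc p r s))) ⟩
  scale a (r *P s) +P (0 ∷ p *P (r *P s))      ∎
  where open SetoidReasoning ≋-setoid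

polyCommutativeSemiring : CommutativeSemiring _ _
polyCommutativeSemiring = record
  { Carrier = Poly ; _≈_ = _≋_ ; _+_ = _+P_ ; _*_ = _*P_ ; 0# = [] ; 1# = oneP
  ; isCommutativeSemiring = isCommutativeSemiringˡ record
    { +-isCommutativeMonoid = record
      { isMonoid = record
        { isSemigroup = record
          { isMagma = record { isEquivalence = ≋-isEquivalence ; ∙-cong = +P-cong }
          ; assoc   = λ p r s → ≡⇒≋ (+P-assoc p r s) }
        ; identity = (λ _ → ≋-refl) , λ p → ≡⇒≋ (+P-identityʳ p) }
      ; comm = λ p r → ≡⇒≋ (+P-comm p r) }
    ; *-isCommutativeMonoid = record
      { isMonoid = record
        { isSemigroup = record
          { isMagma = record { isEquivalence = ≋-isEquivalence ; ∙-cong = *P-cong }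
          ; assoc   = *P-assoc }
        ; identity = *P-identityˡ , λ p → ≋-trans (*P-comm p oneP) (*P-identityˡ p) }
      ; comm = *P-comm }
    ; distribʳ = λ r p s → ≡⇒≋ (*P-distribʳ r p s)
    ; zeroˡ    = λ _ → ≋-refl }
  }

open import Algebra.Solver.Ring.NaturalCoefficients.Default polyCommutativeSemiring
  using (solve; _:+_; _:*_; _:=_; con)

q : Poly
q = qpow 1

0∷-*P : ∀ p r → (0 ∷ p) *P r ≋ 0 ∷ p *P r
0∷-*P p r = +P-cong (scale-zero r) ≋-refl

q-*P : ∀ p → q *P p ≋ 0 ∷ p
q-*P p = ≋-trans (0∷-*P oneP p) (∷-cong refl (*P-identityˡ p))

qpow-+ : ∀ m n → qpow (m + n) ≋ qpow m *P qpow n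
qpow-+ zero    n = ≋-sym (*P-identityˡ (qpow n))
qpow-+ (suc m) n = ≋-trans (∷-cong refl (qpow-+ m n)) (≋-sym (0∷-*P (qpow m) (qpow n)))

qint-sucˡ : ∀ m → qint (suc m) ≋ oneP +P q *P qint m
qint-sucˡ m = ≋-sym (+P-cong (≋-refl {oneP}) (q-*P (qint m)))

qint-sucʳ : ∀ m → qint (suc m) ≋ qint m +P qpow m
qint-sucʳ zero    = ≋-refl
qint-sucʳ (suc m) = ∷-cong refl (qint-sucʳ m)

qint-+ : ∀ m n → qint (m + n) ≋ qint m +P qpow m *P qint n
qint-+ zero    n = ≋-sym (*P-identityˡ (qint n))
qint-+ (suc m) n = ≋-trans (∷-cong refl (qint-+ m n))
                           (≋-sym (+P-cong (≋-refl {1 ∷ qint m}) (0∷-*P (qpow m) (qint n))))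

qint₂ : ℕ → Poly
qint₂ m = qint m *P qint (m ∸ 1)

qint₂-+ : ∀ a k →
  qint₂ a +P qpow (a ∸ 1) *P onePlusQ *P qint a *P qint k +P qpow (a + a) *P qint₂ k ≋ qint₂ (a + k)
qint₂-+ zero k = solve 3 (λ P K K₂ → con 0 :+ con 1 :* P :* con 0 :* K :+ con 1 :* K₂ := K₂) ≋-refl
  onePlusQ (qint k) (qint₂ k)
qint₂-+ (suc a) zero = begin
  qint₂ (suc a) +P qpow a *P onePlusQ *P qint (suc a) *P [] +P qpow (suc a + suc a) *P []
    ≈⟨ solve 3 (λ A₂ X Y → A₂ :+ X :* con 0 :+ Y :* con 0 := A₂) ≋-refl
         (qint₂ (suc a)) (qpow a *P onePlusQ *P qint (suc a)) (qpow (suc a + suc a)) ⟩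
  qint₂ (suc a)                                 ≡⟨ cong qint₂ (sym (+-identityʳ (suc a))) ⟩
  qint₂ (suc a + zero)                          ∎
  where open SetoidReasoning ≋-setoid
-- Every factor is rewritten as a polynomial in q, u = q^a, A = [a] and K = [k]
-- (onePlusQ is definitionally oneP +P q), after which the ring solver applies.
qint₂-+ (suc a) (suc k) = begin
  qint (suc a) *P A +P u *P onePlusQ *P qint (suc a) *P qint (suc k)
    +P qpow (suc a + suc a) *P (qint (suc k) *P K)
    ≈⟨ +P-cong (+P-cong (*P-congˡ A qint-1+a) (*P-cong (*P-congʳ (u *P onePlusQ) qint-1+a) qint-1+k))
               (*P-cong qpow-2+2a (*P-congˡ K qint-1+k)) ⟩
  (A +P u) *P A +P u *P (oneP +P q) *P (A +P u) *P (oneP +P q *P K)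
    +P (q *P u) *P (q *P u) *P ((oneP +P q *P K) *P K)
    ≈⟨ solve 4 (λ q u A K →
         (A :+ u) :* A :+ u :* (con 1 :+ q) :* (A :+ u) :* (con 1 :+ q :* K)
           :+ (q :* u) :* (q :* u) :* ((con 1 :+ q :* K) :* K)
           := ((A :+ u) :+ (q :* u) :* (con 1 :+ q :* K)) :* (A :+ u :* (con 1 :+ q :* K))) ≋-refl q u A K ⟩
  ((A +P u) +P (q *P u) *P (oneP +P q *P K)) *P (A +P u *P (oneP +P q *P K))
    ≈⟨ *P-cong (≋-sym qint-2+a+k) (≋-sym qint-1+a+k) ⟩
  qint₂ (suc a + suc k) ∎
  where
  open SetoidReasoning ≋-setoid
  A = qint a
  u = qpow a
  K = qint k
  qint-1+a : qint (suc a) ≋ A +P u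
  qint-1+a = qint-sucʳ a
  qint-1+k : qint (suc k) ≋ oneP +P q *P K
  qint-1+k = qint-sucˡ k
  qpow-2+2a : qpow (suc a + suc a) ≋ (q *P u) *P (q *P u)
  qpow-2+2a = ≋-trans (qpow-+ (suc a) (suc a)) (*P-cong (qpow-+ 1 a) (qpow-+ 1 a))
  qint-2+a+k : qint (suc a + suc k) ≋ (A +P u) +P (q *P u) *P (oneP +P q *P K)
  qint-2+a+k = ≋-trans (qint-+ (suc a) (suc k)) (+P-cong qint-1+a (*P-cong (qpow-+ 1 a) qint-1+k))
  qint-1+a+k : qint (a + suc k) ≋ A +P u *P (oneP +P q *P K)
  qint-1+a+k = ≋-trans (qint-+ a (suc k)) (+P-cong ≋-refl (*P-congʳ u qint-1+k))

sumWords : ℕ → (List Bool → Poly) → Poly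
sumWords zero    h = h []
sumWords (suc n) h = sumWords n (λ w → h (false ∷ w) +P h (true ∷ w))

sumWords-cong : ∀ n {h g} → (∀ w → length w ≡ n → h w ≋ g w) → sumWords n h ≋ sumWords n g
sumWords-cong zero    e = e [] refl
sumWords-cong (suc n) e = sumWords-cong n λ w len →
  +P-cong (e (false ∷ w) (cong suc len)) (e (true ∷ w) (cong suc len))

sumWords-[] : ∀ n → sumWords n (λ _ → []) ≡ []
sumWords-[] zero    = refl
sumWords-[] (suc n) = sumWords-[] n

sumWords-vanishing : ∀ n {h} → (∀ w → h w ≡ []) → sumWords n h ≋ []
sumWords-vanishing n h≡[] = ≋-trans (sumWords-cong n λ w _ → ≡⇒≋ (h≡[] w)) (≡⇒≋ (sumWords-[] n))

sumWords-+P : ∀ n h g → sumWords n (λ w → h w +P g w) ≋ sumWords n h +P sumWords n g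
sumWords-+P zero    h g = ≋-refl
sumWords-+P (suc n) h g = ≋-trans
  (sumWords-cong n λ w _ →
     ≡⇒≋ (+P-interchange (h (false ∷ w)) (g (false ∷ w)) (h (true ∷ w)) (g (true ∷ w))))
  (sumWords-+P n (λ w → h (false ∷ w) +P h (true ∷ w)) (λ w → g (false ∷ w) +P g (true ∷ w)))

sumWords-*P : ∀ n c {h g} → (∀ w → h w ≋ c *P g w) → sumWords n h ≋ c *P sumWords n g
sumWords-*P zero    c e = e []
sumWords-*P (suc n) c {g = g} e = sumWords-*P n c λ w →
  ≋-trans (+P-cong (e (false ∷ w)) (e (true ∷ w))) (≋-sym (*P-distribˡ c (g (false ∷ w)) (g (true ∷ w))))

sumWords-pairs : ∀ n h → sumWords (suc (suc n)) h ≋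
  (sumWords n (λ w → h (false ∷ false ∷ w)) +P sumWords n (λ w → h (true ∷ false ∷ w))) +P
  (sumWords n (λ w → h (false ∷ true ∷ w)) +P sumWords n (λ w → h (true ∷ true ∷ w)))
sumWords-pairs n h = ≋-trans (sumWords-+P n _ _) (+P-cong (sumWords-+P n _ _) (sumWords-+P n _ _))

sumP-allWords : ∀ n h → sumP (map h (allWords n)) ≋ sumWords n h
sumP-allWords zero    h = ≡⇒≋ (+P-identityʳ (h []))
sumP-allWords (suc n) h = ≋-trans (≡⇒≋ (sumP-doubled (allWords n))) (sumP-allWords n _)
  where
  sumP-doubled : ∀ ws → sumP (map h (concatMap (λ w → (false ∷ w) ∷ (true ∷ w) ∷ []) ws))
                         ≡ sumP (map (λ w → h (false ∷ w) +P h (true ∷ w)) ws)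
  sumP-doubled []       = refl
  sumP-doubled (w ∷ ws) = trans (cong (λ s → h (false ∷ w) +P (h (true ∷ w) +P s)) (sumP-doubled ws))
                                (sym (+P-assoc (h (false ∷ w)) (h (true ∷ w)) _))

when : Bool → Poly → Poly
when b p = if b then p else []

when-[] : ∀ b → when b [] ≡ []
when-[] false = refl
when-[] true  = refl

when-T : ∀ {b p} → T b → when b p ≡ p
when-T {true} _ = refl

when-*P : ∀ b c p → when b (c *P p) ≋ c *P when b p
when-*P false c p = ≋-sym (*P-zeroʳ c)
when-*P true  c p = ≋-refl

when-cong : ∀ b {p r} → p ≋ r → when b p ≋ when b r
when-cong false e = ≋-refl
when-cong true  e = e

when-≡ᵇ-*P : ∀ m a b (c : ℕ → Poly) {p r} → p ≋ c m *P r →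
             when (m ≡ᵇ a) (when b p) ≋ c a *P when (m ≡ᵇ a) (when b r)
when-≡ᵇ-*P m a b c {r = r} e with m ≡ᵇ a | ≡ᵇ⇒≡ m a
... | false | _   = ≋-sym (*P-zeroʳ (c a))
... | true  | m≡a with m≡a _
...   | refl = ≋-trans (when-cong b e) (when-*P b (c m) r)

sumP-filterB : ∀ (P : List Bool → Bool) h ws →
               sumP (map h (filterB P ws)) ≡ sumP (map (λ w → when (P w) (h w)) ws)
sumP-filterB P h []       = refl
sumP-filterB P h (w ∷ ws) with P w
... | true  = cong (h w +P_) (sumP-filterB P h ws)
... | false = sumP-filterB P h ws

zeros+ones : ∀ w → zeros w + ones w ≡ length w
zeros+ones []          = refl
zeros+ones (false ∷ w) = cong suc (zeros+ones w)
zeros+ones (true ∷ w)  = trans (+-suc (zeros w) (ones w)) (cong suc (zeros+ones w))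

weight : List Bool → Poly
weight v = qpow (inv v) *P (onePlusQ ^P ascOdd v)

weight-01 : ∀ w → weight (false ∷ true ∷ w) ≋ qpow (zeros w) *P onePlusQ *P weight w
weight-01 w = begin
  qpow (zeros w + inv w) *P (onePlusQ *P (onePlusQ ^P ascOdd w))
    ≈⟨ *P-congˡ _ (qpow-+ (zeros w) (inv w)) ⟩
  qpow (zeros w) *P qpow (inv w) *P (onePlusQ *P (onePlusQ ^P ascOdd w))
    ≈⟨ solve 4 (λ u v p r → u :* v :* (p :* r) := u :* p :* (v :* r)) ≋-refl
         (qpow (zeros w)) (qpow (inv w)) onePlusQ (onePlusQ ^P ascOdd w) ⟩
  qpow (zeros w) *P onePlusQ *P weight w  ∎
  where open SetoidReasoning ≋-setoid

weight-11 : ∀ w → weight (true ∷ true ∷ w) ≋ qpow (zeros w + zeros w) *P weight w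
weight-11 w = begin
  qpow (zeros w + (zeros w + inv w)) *P (onePlusQ ^P ascOdd w)
    ≡⟨ cong (λ m → qpow m *P (onePlusQ ^P ascOdd w)) (sym (+-assoc (zeros w) (zeros w) (inv w))) ⟩
  qpow (zeros w + zeros w + inv w) *P (onePlusQ ^P ascOdd w)
    ≈⟨ *P-congˡ _ (qpow-+ (zeros w + zeros w) (inv w)) ⟩
  qpow (zeros w + zeros w) *P qpow (inv w) *P (onePlusQ ^P ascOdd w)
    ≈⟨ *P-assoc (qpow (zeros w + zeros w)) (qpow (inv w)) (onePlusQ ^P ascOdd w) ⟩
  qpow (zeros w + zeros w) *P weight w  ∎
  where open SetoidReasoning ≋-setoid

inOmega'' : ℕ → List Bool → Bool
inOmega'' k v = (ones v ≡ᵇ k) ∧ pairsOrdered v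

-- Fixing the number a of zeros, not just the length, makes the inversions
-- created by a leading 1 a constant that can be pulled out of a sum.
Ω-weight : ℕ → ℕ → List Bool → Poly
Ω-weight a k v = when (zeros v ≡ᵇ a) (when (inOmega'' k v) (weight v))

when-inOmega''≡Ω-weight : ∀ {n k} w → length w ≡ n →
                          when (inOmega'' k w) (weight w) ≡ Ω-weight (n ∸ k) k w
when-inOmega''≡Ω-weight {k = k} w refl with ones w ≡ᵇ k | ≡ᵇ⇒≡ (ones w) k
... | false | _ = sym (when-[] _)
... | true  | ones≡k with pairsOrdered w
...   | false = sym (when-[] _)
...   | true  = sym (when-T (≡⇒≡ᵇ (zeros w) (length w ∸ k) zeros≡))
  where
  zeros≡ : zeros w ≡ length w ∸ k
  zeros≡ = trans (sym (m+n∸n≡m (zeros w) k))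
                 (cong (_∸ k) (trans (cong (zeros w +_) (sym (ones≡k _))) (zeros+ones w)))

Ω-weight-10 : ∀ a k w → Ω-weight a k (true ∷ false ∷ w) ≡ []
Ω-weight-10 a k w rewrite ∧-zeroʳ (suc (ones w) ≡ᵇ k) = when-[] _

Ω-weight-01 : ∀ a k w → Ω-weight (suc a) (suc k) (false ∷ true ∷ w) ≋ qpow a *P onePlusQ *P Ω-weight a k w
Ω-weight-01 a k w = when-≡ᵇ-*P (zeros w) a (inOmega'' k w) (λ m → qpow m *P onePlusQ) (weight-01 w)

Ω-weight-11 : ∀ a k w → Ω-weight a (suc (suc k)) (true ∷ true ∷ w) ≋ qpow (a + a) *P Ω-weight a k w
Ω-weight-11 a k w = when-≡ᵇ-*P (zeros w) a (inOmega'' k w) (λ m → qpow (m + m)) (weight-11 w)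

-- The words of Ω''_{a+k,k} starting with x y contribute pairCoefficient x y a k * [a+k-2]!
-- to [k]! [a]! G(a,k). The junk value 0 ∸ 1 is harmless: qint 0 = [] kills that term.
pairCoefficient : Bool → Bool → ℕ → ℕ → Poly
pairCoefficient false false a k = qint₂ a
pairCoefficient true  false a k = []
pairCoefficient false true  a k = qpow (a ∸ 1) *P onePlusQ *P qint a *P qint k
pairCoefficient true  true  a k = qpow (a + a) *P qint₂ k

pair-contribution-vanishing : ∀ n x y a k →
  (∀ w → Ω-weight a k (x ∷ y ∷ w) ≡ []) → pairCoefficient x y a k ≋ [] →
  qfact k *P qfact a *P sumWords n (λ w → Ω-weight a k (x ∷ y ∷ w)) ≋ pairCoefficient x y a k *P qfact n
pair-contribution-vanishing n x y a k h≡[] c≋[] =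
  ≋-trans (*P-congʳ (qfact k *P qfact a) (sumWords-vanishing n h≡[]))
          (≋-trans (*P-zeroʳ (qfact k *P qfact a)) (≋-sym (*P-congˡ (qfact n) c≋[])))

GaussianIdentity : ℕ → Set
GaussianIdentity n = ∀ a k → a + k ≡ n → qfact k *P qfact a *P sumWords n (Ω-weight a k) ≋ qfact n

module _ {n} (ih : GaussianIdentity n) where

  pair-contribution : ∀ x y a k → a + k ≡ suc (suc n) →
    qfact k *P qfact a *P sumWords n (λ w → Ω-weight a k (x ∷ y ∷ w)) ≋ pairCoefficient x y a k *P qfact n
  pair-contribution false false (suc (suc a)) k e = begin
    qfact k *P (qint (2 + a) *P (qint (1 + a) *P qfact a)) *P S
      ≈⟨ solve 5 (λ K A₂ A₁ F S → K :* (A₂ :* (A₁ :* F)) :* S := A₂ :* A₁ :* (K :* F :* S)) ≋-refl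
           (qfact k) (qint (2 + a)) (qint (1 + a)) (qfact a) S ⟩
    qint₂ (2 + a) *P (qfact k *P qfact a *P S)  ≈⟨ *P-congʳ (qint₂ (2 + a)) (ih a k a+k≡n) ⟩
    qint₂ (2 + a) *P qfact n                    ∎
    where
    open SetoidReasoning ≋-setoid
    S = sumWords n (Ω-weight a k)
    a+k≡n : a + k ≡ n
    a+k≡n = suc-injective (suc-injective e)
  pair-contribution false true (suc a) (suc k) e = begin
    K₁ *P qfact k *P (A₁ *P qfact a) *P sumWords n (λ w → Ω-weight (suc a) (suc k) (false ∷ true ∷ w))
      ≈⟨ *P-congʳ (K₁ *P qfact k *P (A₁ *P qfact a)) (sumWords-*P n c (Ω-weight-01 a k)) ⟩
    K₁ *P qfact k *P (A₁ *P qfact a) *P (c *P S)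
      ≈⟨ solve 6 (λ K₁ K A₁ A c S → K₁ :* K :* (A₁ :* A) :* (c :* S) := c :* A₁ :* K₁ :* (K :* A :* S))
           ≋-refl K₁ (qfact k) A₁ (qfact a) c S ⟩
    c *P A₁ *P K₁ *P (qfact k *P qfact a *P S)  ≈⟨ *P-congʳ (c *P A₁ *P K₁) (ih a k a+k≡n) ⟩
    c *P A₁ *P K₁ *P qfact n                    ∎
    where
    open SetoidReasoning ≋-setoid
    c = qpow a *P onePlusQ
    A₁ = qint (1 + a)
    K₁ = qint (1 + k)
    S = sumWords n (Ω-weight a k)
    a+k≡n : a + k ≡ n
    a+k≡n = suc-injective (trans (sym (+-suc a k)) (suc-injective e))
  pair-contribution true true a (suc (suc k)) e = begin
    K₂ *P (K₁ *P qfact k) *P qfact a *P sumWords n (λ w → Ω-weight a (2 + k) (true ∷ true ∷ w))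
      ≈⟨ *P-congʳ (K₂ *P (K₁ *P qfact k) *P qfact a) (sumWords-*P n c (Ω-weight-11 a k)) ⟩
    K₂ *P (K₁ *P qfact k) *P qfact a *P (c *P S)
      ≈⟨ solve 6 (λ K₂ K₁ K A c S → K₂ :* (K₁ :* K) :* A :* (c :* S) := c :* (K₂ :* K₁) :* (K :* A :* S))
           ≋-refl K₂ K₁ (qfact k) (qfact a) c S ⟩
    c *P qint₂ (2 + k) *P (qfact k *P qfact a *P S)  ≈⟨ *P-congʳ (c *P qint₂ (2 + k)) (ih a k a+k≡n) ⟩
    c *P qint₂ (2 + k) *P qfact n                    ∎
    where
    open SetoidReasoning ≋-setoid
    c = qpow (a + a)
    K₁ = qint (1 + k)
    K₂ = qint (2 + k)
    S = sumWords n (Ω-weight a k)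
    a+k≡n : a + k ≡ n
    a+k≡n = suc-injective (trans (sym (+-suc a k)) (suc-injective (trans (sym (+-suc a (suc k))) e)))
  pair-contribution false false zero k _ =
    pair-contribution-vanishing n false false 0 k (λ _ → refl) ≋-refl
  pair-contribution false false (suc zero) k _ =
    pair-contribution-vanishing n false false 1 k (λ _ → refl) (*P-zeroʳ (qint 1))
  pair-contribution true false a k _ =
    pair-contribution-vanishing n true false a k (Ω-weight-10 a k) ≋-refl
  pair-contribution false true zero k _ =
    pair-contribution-vanishing n false true 0 k (λ _ → refl)
      (*P-congˡ (qint k) (*P-zeroʳ (qpow 0 *P onePlusQ)))
  pair-contribution false true (suc a) zero _ =
    pair-contribution-vanishing n false true (suc a) 0 (λ w → when-[] (zeros w ≡ᵇ a))
      (*P-zeroʳ (qpow a *P onePlusQ *P qint (suc a)))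
  pair-contribution true true a zero _ =
    pair-contribution-vanishing n true true a 0 (λ w → when-[] (zeros w ≡ᵇ a))
      (*P-zeroʳ (qpow (a + a)))
  pair-contribution true true a (suc zero) _ =
    pair-contribution-vanishing n true true a 1 (λ w → when-[] (zeros w ≡ᵇ a))
      (≋-trans (*P-congʳ (qpow (a + a)) (*P-zeroʳ (qint 1))) (*P-zeroʳ (qpow (a + a))))

  gaussianIdentity-step : GaussianIdentity (suc (suc n))
  gaussianIdentity-step a k e = begin
    X *P sumWords (2 + n) (Ω-weight a k)
      ≈⟨ *P-congʳ X (sumWords-pairs n (Ω-weight a k)) ⟩
    X *P ((S false false +P S true false) +P (S false true +P S true true))
      ≈⟨ solve 5 (λ X A B C D → X :* ((A :+ B) :+ (C :+ D)) := (X :* A :+ X :* B) :+ (X :* C :+ X :* D))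
           ≋-refl X (S false false) (S true false) (S false true) (S true true) ⟩
    (X *P S false false +P X *P S true false) +P (X *P S false true +P X *P S true true)
      ≈⟨ +P-cong (+P-cong (term false false) (term true false))
                 (+P-cong (term false true) (term true true)) ⟩
    (c false false *P F +P [] *P F) +P (c false true *P F +P c true true *P F)
      ≈⟨ solve 4 (λ F A C D → (A :* F :+ con 0 :* F) :+ (C :* F :+ D :* F) := (A :+ C :+ D) :* F) ≋-refl
           F (c false false) (c false true) (c true true) ⟩
    (qint₂ a +P c false true +P c true true) *P F   ≈⟨ *P-congˡ F (qint₂-+ a k) ⟩
    qint₂ (a + k) *P F                              ≡⟨ cong (λ m → qint₂ m *P F) e ⟩
    qint₂ (2 + n) *P F                              ≈⟨ *P-assoc (qint (2 + n)) (qint (1 + n)) F ⟩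
    qfact (2 + n)                                   ∎
    where
    open SetoidReasoning ≋-setoid
    X = qfact k *P qfact a
    F = qfact n
    S : Bool → Bool → Poly
    S x y = sumWords n (λ w → Ω-weight a k (x ∷ y ∷ w))
    c : Bool → Bool → Poly
    c x y = pairCoefficient x y a k
    term : ∀ x y → X *P S x y ≋ c x y *P F
    term x y = pair-contribution x y a k e

gaussianIdentity : ∀ n → GaussianIdentity n
gaussianIdentity zero          zero       zero       refl = ≡⇒≋ refl
gaussianIdentity (suc zero)    zero       (suc zero) refl = ≡⇒≋ refl
gaussianIdentity (suc zero)    (suc zero) zero       refl = ≡⇒≋ refl
gaussianIdentity (suc (suc n)) = gaussianIdentity-step (gaussianIdentity n)

sumP-Omega'' : ∀ n k → sumP (map weight (Omega'' n k)) ≋ sumWords n (Ω-weight (n ∸ k) k)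
sumP-Omega'' n k = ≋-trans (≡⇒≋ (sumP-filterB (inOmega'' k) weight (allWords n)))
  (≋-trans (sumP-allWords n _) (sumWords-cong n λ w len → ≡⇒≋ (when-inOmega''≡Ω-weight w len)))

corollary2p3 : (n k : ℕ) → k ≤ n →
    qfact k *P qfact (n ∸ k) *P sumP (map (λ v → qpow (inv v) *P (onePlusQ ^P ascOdd v)) (Omega'' n k)) ≈P qfact n
corollary2p3 n k k≤n = coeff-≡ (begin
  qfact k *P qfact (n ∸ k) *P sumP (map weight (Omega'' n k))
    ≈⟨ *P-congʳ (qfact k *P qfact (n ∸ k)) (sumP-Omega'' n k) ⟩
  qfact k *P qfact (n ∸ k) *P sumWords n (Ω-weight (n ∸ k) k)
    ≈⟨ gaussianIdentity n (n ∸ k) k (m∸n+n≡m k≤n) ⟩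
  qfact n ∎)
  where open SetoidReasoning ≋-setoid
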